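{- Let $\mathcal V$ be an ms-full variety in which, for every algebra of $\mathcal V$, each compact congruence is a factor congruence. Then a nontrivial finitely presented algebra $A\in\mathcal V$ is projective in $\mathcal V$ if and only if $A$ is mh-full.
   Context: All algebras are of a fixed finite similarity type. A nontrivial algebra $M$ is minimal if it has no proper subalgebra (equivalently, it is generated by any of its elements). A variety $\mathcal V$ is ms-full if every nontrivial algebra of $\mathcal V$ has at least one minimal subalgebra. An algebra $A\in\mathcal V$ is mh-full if every minimal algebra of $\mathcal V$ is (isomorphic to) a homomorphic image of $A$. A congruence $\theta$ on $A$ is a factor congruence if there is a congruence $\theta'$ with $\theta\cap\theta'$ the identity congruence, $\theta\vee\theta'$ the total congruence, and $\theta\circ\theta'=\theta'\circ\theta$. A compact congruence is one generated by finitely many pairs. An algebra is finitely presented in $\mathcal V$ if it is isomorphic to $F_{\mathcal V}(n)/\theta$ for some free algebra $F_{\mathcal V}(n)$ of finite rank $n$ and compact congruence $\theta$. An algebra is projective in $\mathcal V$ iff it is a retract of a free algebra of $\mathcal V$. -}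

module Defs where

open import Data.Nat using (ℕ)
open import Data.Fin using (Fin)
open import Data.List using (List)
open import Data.List.Membership.Propositional using (_∈_)
open import Data.Product using (Σ; Σ-syntax; _×_; _,_; proj₁; proj₂)
open import Relation.Nullary using (¬_)
open import Relation.Binary using (IsEquivalence)
open import Function using (_∘_)

record Signature : Set where
  field
    nOps  : ℕ
    arity : Fin nOps → ℕ

module Theory (Sig : Signature) where
  open Signature Sig

  data Term (X : Set) : Set where
    var : X → Term X
    op  : (f : Fin nOps) → (Fin (arity f) → Term X) → Term X

  subst : {X Y : Set} → (X → Term Y) → Term X → Term Y
  subst σ (var x)   = σ x
  subst σ (op f ts) = op f (λ i → subst σ (ts i))

  -- A set of identities (in variables ℕ); the variety V is the class of
  -- algebras satisfying all of them.
  Identities : Set₁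
  Identities = Term ℕ → Term ℕ → Set

  record Algebra : Set₁ where
    field
      Carrier : Set
      _≈_     : Carrier → Carrier → Set
      isEquiv : IsEquivalence _≈_
      ⟦_⟧     : (f : Fin nOps) → (Fin (arity f) → Carrier) → Carrier
      ⟦⟧-cong : ∀ f {xs ys : Fin (arity f) → Carrier} →
                (∀ i → xs i ≈ ys i) → ⟦ f ⟧ xs ≈ ⟦ f ⟧ ys

  open Algebra public

  eval : (A : Algebra) {X : Set} → (X → Carrier A) → Term X → Carrier A
  eval A ρ (var x)   = ρ x
  eval A ρ (op f ts) = ⟦ A ⟧ f (λ i → eval A ρ (ts i))

  InV : Identities → Algebra → Set
  InV E A = ∀ l r → E l r → (ρ : ℕ → Carrier A) → _≈_ A (eval A ρ l) (eval A ρ r)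

  Nontrivial : Algebra → Set
  Nontrivial A = Σ[ x ∈ Carrier A ] Σ[ y ∈ Carrier A ] ¬ (_≈_ A x y)

  record Hom (A B : Algebra) : Set where
    field
      fun    : Carrier A → Carrier B
      fun-cong : ∀ {x y} → _≈_ A x y → _≈_ B (fun x) (fun y)
      fun-op : ∀ f (xs : Fin (arity f) → Carrier A) →
               _≈_ B (fun (⟦ A ⟧ f xs)) (⟦ B ⟧ f (fun ∘ xs))

  open Hom public

  Surjective : {A B : Algebra} → Hom A B → Set
  Surjective {A} {B} h = ∀ b → Σ[ a ∈ Carrier A ] _≈_ B (fun h a) b

  _≅_ : Algebra → Algebra → Set
  A ≅ B = Σ[ h ∈ Hom A B ] Σ[ g ∈ Hom B A ]
            ((∀ a → _≈_ A (fun g (fun h a)) a) × (∀ b → _≈_ B (fun h (fun g b)) b))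

  record Congruence (A : Algebra) : Set₁ where
    field
      rel     : Carrier A → Carrier A → Set
      equiv   : IsEquivalence rel
      refines : ∀ {x y} → _≈_ A x y → rel x y
      compat  : ∀ f {xs ys : Fin (arity f) → Carrier A} →
                (∀ i → rel (xs i) (ys i)) → rel (⟦ A ⟧ f xs) (⟦ A ⟧ f ys)

  open Congruence public

  Quotient : (A : Algebra) → Congruence A → Algebra
  Quotient A θ = record
    { Carrier = Carrier A
    ; _≈_ = rel θ
    ; isEquiv = equiv θ
    ; ⟦_⟧ = ⟦ A ⟧
    ; ⟦⟧-cong = compat θ }

  data CgRel (A : Algebra) (ps : List (Carrier A × Carrier A)) :
             Carrier A → Carrier A → Set where
    gen   : ∀ {x y} → (x , y) ∈ ps → CgRel A ps x y
    base  : ∀ {x y} → _≈_ A x y → CgRel A ps x y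
    sym   : ∀ {x y} → CgRel A ps x y → CgRel A ps y x
    trans : ∀ {x y z} → CgRel A ps x y → CgRel A ps y z → CgRel A ps x z
    cong  : ∀ f {xs ys : Fin (arity f) → Carrier A} →
            (∀ i → CgRel A ps (xs i) (ys i)) → CgRel A ps (⟦ A ⟧ f xs) (⟦ A ⟧ f ys)

  Compact : (A : Algebra) → Congruence A → Set
  Compact A θ = Σ[ ps ∈ List (Carrier A × Carrier A) ]
                  ((∀ x y → rel θ x y → CgRel A ps x y) ×
                   (∀ x y → CgRel A ps x y → rel θ x y))

  data JoinRel (A : Algebra) (θ θ' : Congruence A) : Carrier A → Carrier A → Set where
    inl   : ∀ {x y} → rel θ x y → JoinRel A θ θ' x y
    inr   : ∀ {x y} → rel θ' x y → JoinRel A θ θ' x y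
    trans : ∀ {x y z} → JoinRel A θ θ' x y → JoinRel A θ θ' y z → JoinRel A θ θ' x z

  Comp : (A : Algebra) → Congruence A → Congruence A → Carrier A → Carrier A → Set
  Comp A θ θ' x z = Σ[ y ∈ Carrier A ] (rel θ x y × rel θ' y z)

  IsFactorCongruence : (A : Algebra) → Congruence A → Set₁
  IsFactorCongruence A θ = Σ[ θ' ∈ Congruence A ]
      ( (∀ x y → rel θ x y → rel θ' x y → _≈_ A x y)
      × (∀ x y → JoinRel A θ θ' x y)
      × (∀ x z → Comp A θ θ' x z → Comp A θ' θ x z)
      × (∀ x z → Comp A θ' θ x z → Comp A θ θ' x z))

  record Subuniverse (A : Algebra) : Set₁ where
    field
      pred   : Carrier A → Set
      resp   : ∀ {x y} → _≈_ A x y → pred x → pred y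
      closed : ∀ f (xs : Fin (arity f) → Carrier A) →
               (∀ i → pred (xs i)) → pred (⟦ A ⟧ f xs)

  open Subuniverse public

  SubAlg : (A : Algebra) → Subuniverse A → Algebra
  SubAlg A S = record
    { Carrier = Σ[ x ∈ Carrier A ] pred S x
    ; _≈_ = λ p q → _≈_ A (proj₁ p) (proj₁ q)
    ; isEquiv = record
        { refl = IsEquivalence.refl (isEquiv A)
        ; sym = IsEquivalence.sym (isEquiv A)
        ; trans = IsEquivalence.trans (isEquiv A) }
    ; ⟦_⟧ = λ f xs → ⟦ A ⟧ f (proj₁ ∘ xs) , closed S f (proj₁ ∘ xs) (proj₂ ∘ xs)
    ; ⟦⟧-cong = λ f eq → ⟦⟧-cong A f eq }

  IsMinimal : Algebra → Set₁
  IsMinimal M = Nontrivial M ×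
    ((S : Subuniverse M) → Σ[ x ∈ Carrier M ] pred S x → ∀ y → pred S y)

  data Deriv (E : Identities) (X : Set) : Term X → Term X → Set where
    ax    : ∀ {l r} → E l r → (σ : ℕ → Term X) → Deriv E X (subst σ l) (subst σ r)
    refl  : ∀ {t} → Deriv E X t t
    sym   : ∀ {t u} → Deriv E X t u → Deriv E X u t
    trans : ∀ {t u v} → Deriv E X t u → Deriv E X u v → Deriv E X t v
    cong  : ∀ f {ts us : Fin (arity f) → Term X} →
            (∀ i → Deriv E X (ts i) (us i)) → Deriv E X (op f ts) (op f us)

  Free : Identities → Set → Algebra
  Free E X = record
    { Carrier = Term X
    ; _≈_ = Deriv E X
    ; isEquiv = record { refl = refl ; sym = sym ; trans = trans }
    ; ⟦_⟧ = op
    ; ⟦⟧-cong = cong }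

  MsFull : Identities → Set₁
  MsFull E = (A : Algebra) → InV E A → Nontrivial A →
             Σ[ S ∈ Subuniverse A ] IsMinimal (SubAlg A S)

  CompactAreFactor : Identities → Set₁
  CompactAreFactor E = (A : Algebra) → InV E A →
                       (θ : Congruence A) → Compact A θ → IsFactorCongruence A θ

  MhFull : Identities → Algebra → Set₁
  MhFull E A = (M : Algebra) → InV E M → IsMinimal M →
               Σ[ h ∈ Hom A M ] Surjective h

  FinitelyPresented : Identities → Algebra → Set₁
  FinitelyPresented E A = Σ[ n ∈ ℕ ] Σ[ θ ∈ Congruence (Free E (Fin n)) ]
      (Compact (Free E (Fin n)) θ × (A ≅ Quotient (Free E (Fin n)) θ))

  Projective : Identities → Algebra → Set₁
  Projective E A = Σ[ X ∈ Set ] Σ[ r ∈ Hom (Free E X) A ] Σ[ s ∈ Hom A (Free E X) ]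
      (∀ a → _≈_ A (fun r (fun s a)) a)

-- A projective algebra is a retract of a free algebra, and a free algebra maps onto every
-- minimal algebra (send every generator to one element; the image is a subalgebra, hence
-- everything), so A is mh-full.  Conversely, write A ≅ F/θ with F free of finite rank and θ
-- compact.  Then θ is a factor congruence with complement θ', so F ≅ F/θ × F/θ'.  A minimal
-- subalgebra M of A × F/θ' (which exists by ms-full) is a homomorphic image of A by mh-full,
-- which yields a homomorphism A → F/θ'.  Pairing it with A ≅ F/θ gives a homomorphism
-- A → F that splits the quotient map F → F/θ ≅ A.
module Submission where

open import Defs
open import Data.Product using (_×_; Σ-syntax; _,_; proj₁; proj₂)
open import Data.Nat using (ℕ)
open import Data.Fin using (Fin)
open import Relation.Binary using (IsEquivalence)
open import Function using (_∘_)

module _ (Sig : Signature) where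
  open Signature Sig
  open Theory Sig

  module ≈ (A : Algebra) = IsEquivalence (isEquiv A)
  module Cg {A : Algebra} (θ : Congruence A) = IsEquivalence (equiv θ)

  _∘ₕ_ : {A B C : Algebra} → Hom B C → Hom A B → Hom A C
  _∘ₕ_ {C = C} g h = record
    { fun = fun g ∘ fun h
    ; fun-cong = fun-cong g ∘ fun-cong h
    ; fun-op = λ f xs → ≈.trans C (fun-cong g (fun-op h f xs)) (fun-op g f (fun h ∘ xs)) }

  quotientHom : (A : Algebra) (θ : Congruence A) → Hom A (Quotient A θ)
  quotientHom A θ = record { fun = λ x → x ; fun-cong = refines θ ; fun-op = λ f xs → Cg.refl θ }

  inclusionHom : (A : Algebra) (S : Subuniverse A) → Hom (SubAlg A S) A
  inclusionHom A S = record { fun = proj₁ ; fun-cong = λ e → e ; fun-op = λ f xs → ≈.refl A }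

  Prod : Algebra → Algebra → Algebra
  Prod A B = record
    { Carrier = Carrier A × Carrier B
    ; _≈_ = λ p q → _≈_ A (proj₁ p) (proj₁ q) × _≈_ B (proj₂ p) (proj₂ q)
    ; isEquiv = record
      { refl = ≈.refl A , ≈.refl B
      ; sym = λ (e , e') → ≈.sym A e , ≈.sym B e'
      ; trans = λ (e₁ , e₁') (e₂ , e₂') → ≈.trans A e₁ e₂ , ≈.trans B e₁' e₂' }
    ; ⟦_⟧ = λ f xs → ⟦ A ⟧ f (proj₁ ∘ xs) , ⟦ B ⟧ f (proj₂ ∘ xs)
    ; ⟦⟧-cong = λ f eq → ⟦⟧-cong A f (proj₁ ∘ eq) , ⟦⟧-cong B f (proj₂ ∘ eq) }

  π₁ : (A B : Algebra) → Hom (Prod A B) A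
  π₁ A B = record { fun = proj₁ ; fun-cong = proj₁ ; fun-op = λ f xs → ≈.refl A }

  π₂ : (A B : Algebra) → Hom (Prod A B) B
  π₂ A B = record { fun = proj₂ ; fun-cong = proj₂ ; fun-op = λ f xs → ≈.refl B }

  Prod-nontrivial : (A B : Algebra) → Nontrivial A → Carrier B → Nontrivial (Prod A B)
  Prod-nontrivial A B (x , y , x≉y) b = (x , b) , (y , b) , x≉y ∘ proj₁

  fun-eval : {A B : Algebra} (h : Hom A B) {X : Set} (ρ : X → Carrier A) (t : Term X) →
    _≈_ B (fun h (eval A ρ t)) (eval B (fun h ∘ ρ) t)
  fun-eval {B = B} h ρ (var x) = ≈.refl B
  fun-eval {A} {B} h ρ (op f ts) =
    ≈.trans B (fun-op h f (λ i → eval A ρ (ts i))) (⟦⟧-cong B f (λ i → fun-eval h ρ (ts i)))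

  eval-subst : (M : Algebra) {X Y : Set} (ρ : Y → Carrier M) (σ : X → Term Y) (t : Term X) →
    _≈_ M (eval M ρ (subst σ t)) (eval M (eval M ρ ∘ σ) t)
  eval-subst M ρ σ (var x) = ≈.refl M
  eval-subst M ρ σ (op f ts) = ⟦⟧-cong M f (λ i → eval-subst M ρ σ (ts i))

  image : {A M : Algebra} → Hom A M → Subuniverse M
  image {A} {M} k = record
    { pred = λ y → Σ[ a ∈ Carrier A ] _≈_ M (fun k a) y
    ; resp = λ e (a , ka≈y) → a , ≈.trans M ka≈y e
    ; closed = λ f ys ps → ⟦ A ⟧ f (proj₁ ∘ ps) ,
        ≈.trans M (fun-op k f (proj₁ ∘ ps)) (⟦⟧-cong M f (proj₂ ∘ ps)) }

  minimal⇒surjective : {A M : Algebra} → IsMinimal M → Carrier A → (k : Hom A M) → Surjective k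
  minimal⇒surjective {M = M} (_ , noProper) a k = noProper (image k) (fun k a , a , ≈.refl M)

  join⊆comp : (A : Algebra) (θ θ' : Congruence A) →
    (∀ x z → Comp A θ' θ x z → Comp A θ θ' x z) →
    ∀ {x y} → JoinRel A θ θ' x y → Comp A θ θ' x y
  join⊆comp A θ θ' perm (inl {y = y} p) = y , p , Cg.refl θ'
  join⊆comp A θ θ' perm (inr {x = x} q) = x , Cg.refl θ , q
  join⊆comp A θ θ' perm (trans {y = y} j k)
    with join⊆comp A θ θ' perm j | join⊆comp A θ θ' perm k
  ... | u , xθu , uθ'y | v , yθv , vθ'z with perm u v (y , uθ'y , yθv)
  ... | w , uθw , wθ'v = w , Cg.trans θ xθu uθw , Cg.trans θ' wθ'v vθ'z

  -- A factor congruence θ with complement θ' splits F as F/θ × F/θ', so a pair of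
  -- homomorphisms into F/θ and F/θ' lifts to a single homomorphism into F.
  module _ {F : Algebra} {θ : Congruence F} (factor : IsFactorCongruence F θ) where
    private
      θ' = proj₁ factor
      meet = proj₁ (proj₂ factor)
      join = proj₁ (proj₂ (proj₂ factor))
      perm = proj₂ (proj₂ (proj₂ (proj₂ factor)))

    factor-lift : {C : Algebra} (u : Hom C (Quotient F θ)) (v : Hom C (Quotient F θ')) →
      Σ[ s ∈ Hom C F ] (∀ c → rel θ (fun u c) (fun s c))
    factor-lift {C} u v = s , uθs
      where
        chinese : ∀ c → Comp F θ θ' (fun u c) (fun v c)
        chinese c = join⊆comp F θ θ' perm (join (fun u c) (fun v c))

        uθs : ∀ c → rel θ (fun u c) (proj₁ (chinese c))
        uθs c = proj₁ (proj₂ (chinese c))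

        sθ'v : ∀ c → rel θ' (proj₁ (chinese c)) (fun v c)
        sθ'v c = proj₂ (proj₂ (chinese c))

        meet-via : ∀ {x y a b a' b'} →
          rel θ a x → rel θ a b → rel θ b y → rel θ' x a' → rel θ' a' b' → rel θ' y b' →
          _≈_ F x y
        meet-via aθx aθb bθy xθ'a' a'θ'b' yθ'b' = meet _ _
          (Cg.trans θ (Cg.sym θ aθx) (Cg.trans θ aθb bθy))
          (Cg.trans θ' xθ'a' (Cg.trans θ' a'θ'b' (Cg.sym θ' yθ'b')))

        s : Hom C F
        s = record
          { fun = proj₁ ∘ chinese
          ; fun-cong = λ {c} {c'} e →
              meet-via (uθs c) (fun-cong u e) (uθs c') (sθ'v c) (fun-cong v e) (sθ'v c')
          ; fun-op = λ f cs →
              meet-via (uθs (⟦ C ⟧ f cs)) (fun-op u f cs) (compat θ f (uθs ∘ cs))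
                       (sθ'v (⟦ C ⟧ f cs)) (fun-op v f cs) (compat θ' f (sθ'v ∘ cs)) }

  module _ (E : Identities) where

    identities-hold-on-image : {A B : Algebra} (h : Hom A B) → InV E B →
      ∀ l r → E l r → (ρ : ℕ → Carrier A) → _≈_ B (fun h (eval A ρ l)) (fun h (eval A ρ r))
    identities-hold-on-image {A} {B} h vB l r e ρ =
      ≈.trans B (fun-eval h ρ l) (≈.trans B (vB l r e (fun h ∘ ρ)) (≈.sym B (fun-eval h ρ r)))

    Quotient-InV : (A : Algebra) → InV E A → (θ : Congruence A) → InV E (Quotient A θ)
    Quotient-InV A vA θ l r e ρ =
      Cg.trans θ (Cg.sym θ (fun-eval q ρ l)) (Cg.trans θ (refines θ (vA l r e ρ)) (fun-eval q ρ r))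
      where q = quotientHom A θ

    SubAlg-InV : (A : Algebra) → InV E A → (S : Subuniverse A) → InV E (SubAlg A S)
    SubAlg-InV A vA S = identities-hold-on-image (inclusionHom A S) vA

    Prod-InV : (A B : Algebra) → InV E A → InV E B → InV E (Prod A B)
    Prod-InV A B vA vB l r e ρ =
      identities-hold-on-image (π₁ A B) vA l r e ρ , identities-hold-on-image (π₂ A B) vB l r e ρ

    eval-sound : (M : Algebra) → InV E M → {X : Set} (ρ : X → Carrier M) {t u : Term X} →
      Deriv E X t u → _≈_ M (eval M ρ t) (eval M ρ u)
    eval-sound M vM ρ (ax {l} {r} e σ) =
      ≈.trans M (eval-subst M ρ σ l)
        (≈.trans M (vM l r e (eval M ρ ∘ σ)) (≈.sym M (eval-subst M ρ σ r)))
    eval-sound M vM ρ refl = ≈.refl M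
    eval-sound M vM ρ (sym d) = ≈.sym M (eval-sound M vM ρ d)
    eval-sound M vM ρ (trans d d') = ≈.trans M (eval-sound M vM ρ d) (eval-sound M vM ρ d')
    eval-sound M vM ρ (cong f ds) = ⟦⟧-cong M f (λ i → eval-sound M vM ρ (ds i))

    evalHom : (M : Algebra) → InV E M → {X : Set} → (X → Carrier M) → Hom (Free E X) M
    evalHom M vM ρ = record
      { fun = eval M ρ ; fun-cong = eval-sound M vM ρ ; fun-op = λ f xs → ≈.refl M }

    eval-Free : {X : Set} (σ : ℕ → Term X) (t : Term ℕ) → Deriv E X (eval (Free E X) σ t) (subst σ t)
    eval-Free σ (var x) = refl
    eval-Free σ (op f ts) = cong f (λ i → eval-Free σ (ts i))

    Free-InV : (X : Set) → InV E (Free E X)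
    Free-InV X l r e σ = trans (eval-Free σ l) (trans (ax e σ) (sym (eval-Free σ r)))

    projective⇒mhFull : (A : Algebra) → Nontrivial A → Projective E A → MhFull E A
    projective⇒mhFull A (a , _) (X , _ , s , _) M vM minM =
      k , minimal⇒surjective minM a k
      where
        k : Hom A M
        k = evalHom M vM (λ _ → proj₁ (proj₁ minM)) ∘ₕ s

    mhFull⇒hom : MsFull E → (A B : Algebra) → InV E A → InV E B → Nontrivial A → Carrier B →
      MhFull E A → Hom A B
    mhFull⇒hom msFull A B vA vB ntA b mh = π₂ A B ∘ₕ (inclusionHom P S ∘ₕ proj₁ (mh M vM minM))
      where
        P = Prod A B
        vP = Prod-InV A B vA vB
        minimalSub = msFull P vP (Prod-nontrivial A B ntA b)
        S = proj₁ minimalSub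
        minM = proj₂ minimalSub
        M = SubAlg P S
        vM = SubAlg-InV P vP S

    mhFull⇒projective : MsFull E → CompactAreFactor E → (A : Algebra) → InV E A →
      Nontrivial A → FinitelyPresented E A → MhFull E A → Projective E A
    mhFull⇒projective msFull compactFactor A vA ntA (n , θ , compact , h , g , gh , _) mh =
      Fin n , g ∘ₕ quotientHom F θ , s , retract
      where
        F = Free E (Fin n)
        factor = compactFactor F (Free-InV (Fin n)) θ compact
        θ' = proj₁ factor
        φ : Hom A (Quotient F θ')
        φ = mhFull⇒hom msFull A (Quotient F θ') vA (Quotient-InV F (Free-InV (Fin n)) θ')
              ntA (fun h (proj₁ ntA)) mh
        lift = factor-lift factor h φ
        s = proj₁ lift
        retract : ∀ a → _≈_ A (fun g (fun s a)) a
        retract a = ≈.trans A (fun-cong g (Cg.sym θ (proj₂ lift a))) (gh a)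

mainTheorem1 : (Sig : Signature) (E : Theory.Identities Sig) →
    Theory.MsFull Sig E → Theory.CompactAreFactor Sig E →
    (A : Theory.Algebra Sig) → Theory.InV Sig E A → Theory.Nontrivial Sig A →
    Theory.FinitelyPresented Sig E A →
    ((Theory.Projective Sig E A → Theory.MhFull Sig E A) ×
    (Theory.MhFull Sig E A → Theory.Projective Sig E A))
mainTheorem1 Sig E msFull compactFactor A vA ntA fp =
  projective⇒mhFull Sig E A ntA , mhFull⇒projective Sig E msFull compactFactor A vA ntA fp
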